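{- Let $n\ge k\ge1$. Let $X$ be the canonical completion of an $(n,k)$ left Gog trapezoid. Let $Y$ be the triangle obtained by applying the standard procedure to the $n-k+1$ rightmost NW-SE diagonals of $X$, namely those with indices $j=k,\dots,n$. Then $Y$ is a Gelfand-Tsetlin triangle, and $Y_{i+l,k+l}=X_{i,k}$ for all $i$ with $n\ge i\ge k$ and all $1\le l\le n-i$.
   Context: A Gelfand-Tsetlin triangle of size $n$ is an array $X=(X_{i,j})_{n\ge i\ge j\ge1}$ of positive integers with $X_{i+1,j}\le X_{i,j}\le X_{i+1,j+1}$ for $n-1\ge i\ge j\ge 1$. Row $i$ consists of $X_{i,1},\dots,X_{i,i}$. The $j$-th NW-SE diagonal consists of the entries $(X_{i,j})_{n\ge i\ge j}$, read from NW ($i=n$) to SE ($i=j$). A Gog triangle of size $n$ is a Gelfand-Tsetlin triangle with strictly increasing rows and with $X_{n,j}=j$ for all $j$. An $(n,k)$ left Gog trapezoid is the restriction $(X_{i,j})_{j\le k}$ of a Gog triangle of size $n$. Its canonical completion is the entrywise smallest Gog triangle of size $n$ restricting to it; this exists because Gog triangles are closed under entrywise min. An inversion of an array $Z$ is a pair $(i,j)$ with $Z_{i,j}=Z_{i+1,j}$. An inversion $(i,j)$ covers the positions $(i+p,j+p)$ for $1\le p\le n-i$. Standard procedure on the NW-SE diagonals $j=k,\dots,n$: start with $Y=X$. Process the diagonals in the order $j=n,n-1,\dots,k$. Within diagonal $j$, process $i=n-1,n-2,\dots,j$. Whenever the current array satisfies $Y_{i,j}=Y_{i+1,j}$, subtract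 $1$ from every entry $Y_{i+p,j+p}$ with $1\le p\le n-i$. -}

module Defs where

open import Data.Nat using (ℕ; zero; suc; _+_; _∸_; _≤_; _<_; _≤?_; _<?_; _≟_)
open import Data.Bool using (Bool; if_then_else_; _∧_)
open import Data.Product using (_×_; Σ)
open import Relation.Nullary using (does)
open import Relation.Binary.PropositionalEquality using (_≡_)

-- An array X with entries X i j (only the entries n ≥ i ≥ j ≥ 1 matter).
Array : Set
Array = ℕ → ℕ → ℕ

IsGT : ℕ → Array → Set
IsGT n X =
  (∀ i j → 1 ≤ j → j ≤ i → i ≤ n → 1 ≤ X i j) ×
  (∀ i j → 1 ≤ j → j ≤ i → suc i ≤ n →
     X (suc i) j ≤ X i j × X i j ≤ X (suc i) (suc j))

IsGog : ℕ → Array → Set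
IsGog n X =
  IsGT n X ×
  (∀ i j → 1 ≤ j → suc j ≤ i → i ≤ n → X i j < X i (suc j)) ×
  (∀ j → 1 ≤ j → j ≤ n → X n j ≡ j)

Restricts : ℕ → ℕ → Array → Array → Set
Restricts n k Z T = ∀ i j → 1 ≤ j → j ≤ k → j ≤ i → i ≤ n → Z i j ≡ T i j

IsLeftGogTrapezoid : ℕ → ℕ → Array → Set
IsLeftGogTrapezoid n k T = Σ Array (λ Z → IsGog n Z × Restricts n k Z T)

IsCanonicalCompletion : ℕ → ℕ → Array → Array → Set
IsCanonicalCompletion n k T X =
  IsGog n X × Restricts n k X T ×
  (∀ Z → IsGog n Z → Restricts n k Z T →
     ∀ i j → 1 ≤ j → j ≤ i → i ≤ n → X i j ≤ Z i j)

-- Position (a,b) is covered by the inversion (i,j):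
-- (a,b) = (i+p, j+p) with 1 ≤ p ≤ n-i.
covered? : ℕ → ℕ → ℕ → ℕ → ℕ → Bool
covered? n i j a b = does (i <? a) ∧ does (a ≤? n) ∧ does (b ≟ j + (a ∸ i))

step : ℕ → ℕ → ℕ → Array → Array
step n i j Y =
  if does (Y i j ≟ Y (suc i) j)
  then (λ a b → if covered? n i j a b then Y a b ∸ 1 else Y a b)
  else Y

-- rowsLoop n j t Y processes i = j+t-1, j+t-2, ..., j (in this order).
rowsLoop : ℕ → ℕ → ℕ → Array → Array
rowsLoop n j zero    Y = Y
rowsLoop n j (suc t) Y = rowsLoop n j t (step n (j + t) j Y)

processDiagonal : ℕ → ℕ → Array → Array
processDiagonal n j = rowsLoop n j (n ∸ j)

-- diagLoop n k t Y processes diagonals j = k+t-1, ..., k (in this order).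
diagLoop : ℕ → ℕ → ℕ → Array → Array
diagLoop n k zero    Y = Y
diagLoop n k (suc t) Y = diagLoop n k t (processDiagonal n (k + t) Y)

standardProcedure : ℕ → ℕ → Array → Array
standardProcedure n k = diagLoop n k (suc (n ∸ k))

module Submission where

-- Let X be the canonical completion and k ≤ j ≤ i < n.
-- Minimality of X forces every free entry X (i+1) (j+1) down to the largest
-- of its lower bounds in a Gog triangle; a downward induction on i turns this
-- into X (i+1) (j+1) ≤ max (X i j) (X (i+1) j + 1).  Hence along the
-- diagonals j ≥ k the entry below-right of an inversion exceeds X i j by
-- exactly one, and every other such entry equals X i j ('DiagonalRule').

open import Defs
open import Data.Nat using (ℕ; zero; suc; _+_; _∸_; _≤_; _<_; _⊔_; _⊓_; z≤n; s≤s; _≤?_; _<?_; _≟_)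
open import Data.Nat.Properties
open import Data.Bool using (true; false; if_then_else_; _∧_)
open import Data.Bool.Properties using (if-cong; ∧-conicalˡ; ∧-conicalʳ)
open import Data.Product using (_×_; _,_; proj₁; proj₂; ∃)
open import Data.Sum using (inj₁; inj₂)
open import Function.Bundles using (mk⇔)
open import Relation.Nullary using (Dec; yes; no; does; ¬_; contradiction)
open import Relation.Nullary.Decidable using (dec-true; dec-false; does-⇔; _×-dec_)
open import Relation.Binary.PropositionalEquality
open ≡-Reasoning

-- Entry (a, b) right of column c is read off column c at row a - (b - c);
-- for b ≤ c both subtractions vanish and the entry of X is kept.
shiftAlong : ℕ → Array → Array
shiftAlong c X a b = X (a ∸ (b ∸ c)) (b ⊓ c)

shiftAlong-left : ∀ {c} X a {b} → b ≤ c → shiftAlong c X a b ≡ X a b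
shiftAlong-left X a b≤c = cong₂ X (cong (a ∸_) (m≤n⇒m∸n≡0 b≤c)) (m≤n⇒m⊓n≡m b≤c)

shiftAlong-diagonal : ∀ {c} X s p → shiftAlong c X (s + p) (c + p) ≡ X s c
shiftAlong-diagonal {c} X s p =
  cong₂ X (trans (cong (s + p ∸_) (m+n∸m≡n c p)) (m+n∸n≡m s p)) (m≥n⇒m⊓n≡n (m≤m+n c p))

shiftAlong-step : ∀ {c} X a {b} → c ≤ b → shiftAlong c X (suc a) (suc b) ≡ shiftAlong c X a b
shiftAlong-step {c} X a {b} c≤b =
  cong₂ X (cong (suc a ∸_) (+-∸-assoc 1 c≤b))
          (trans (m≥n⇒m⊓n≡n (m≤n⇒m≤1+n c≤b)) (sym (m≥n⇒m⊓n≡n c≤b)))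

data Diagonal (c : ℕ) : ℕ → ℕ → Set where
  on-diagonal : ∀ s p → c ≤ s → Diagonal c (s + p) (c + p)

diagonal : ∀ {c a b} → c ≤ b → b ≤ a → Diagonal c a b
diagonal {c} {a} {b} c≤b b≤a =
  subst₂ (Diagonal c) (m∸n+n≡m p≤a) (m+[n∸m]≡n c≤b) (on-diagonal (a ∸ p) p c≤s)
  where
    p : ℕ
    p = b ∸ c
    p≤a : p ≤ a
    p≤a = ≤-trans (m∸n≤m b c) b≤a
    c≤s : c ≤ a ∸ p
    c≤s = m+n≤o⇒m≤o∸n c (subst (_≤ a) (sym (m+[n∸m]≡n c≤b)) b≤a)

Agree : ℕ → Array → Array → Set
Agree n Y Z = ∀ a b → b ≤ a → a ≤ n → Y a b ≡ Z a b

Agree-sym : ∀ {n Y Z} → Agree n Y Z → Agree n Z Y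
Agree-sym Y≈Z a b b≤a a≤n = sym (Y≈Z a b b≤a a≤n)

Agree-trans : ∀ {n Y Z W} → Agree n Y Z → Agree n Z W → Agree n Y W
Agree-trans Y≈Z Z≈W a b b≤a a≤n = trans (Y≈Z a b b≤a a≤n) (Z≈W a b b≤a a≤n)

IsGT-resp : ∀ {n Y Z} → Agree n Y Z → IsGT n Y → IsGT n Z
IsGT-resp {n} {Y} {Z} Y≈Z (pos , gt) = pos′ , gt′
  where
    pos′ : ∀ a b → 1 ≤ b → b ≤ a → a ≤ n → 1 ≤ Z a b
    pos′ a b 1≤b b≤a a≤n = subst (1 ≤_) (Y≈Z a b b≤a a≤n) (pos a b 1≤b b≤a a≤n)
    gt′ : ∀ a b → 1 ≤ b → b ≤ a → suc a ≤ n → Z (suc a) b ≤ Z a b × Z a b ≤ Z (suc a) (suc b)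
    gt′ a b 1≤b b≤a a<n =
      subst₂ _≤_ agree-below agree-here (proj₁ (gt a b 1≤b b≤a a<n)) ,
      subst₂ _≤_ agree-here agree-right (proj₂ (gt a b 1≤b b≤a a<n))
      where
        agree-here : Y a b ≡ Z a b
        agree-here = Y≈Z a b b≤a (<⇒≤ a<n)
        agree-below : Y (suc a) b ≡ Z (suc a) b
        agree-below = Y≈Z (suc a) b (m≤n⇒m≤1+n b≤a) a<n
        agree-right : Y (suc a) (suc b) ≡ Z (suc a) (suc b)
        agree-right = Y≈Z (suc a) (suc b) (s≤s b≤a) a<n

-- Shifting a nonzero column preserves the Gelfand-Tsetlin inequalities:
-- left of column c nothing changes, right of it they reduce to column c of X.
shiftAlong-GT : ∀ {n c X} → 1 ≤ c → IsGT n X → IsGT n (shiftAlong c X)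
shiftAlong-GT {n} {c} {X} 1≤c (pos , gt) = pos′ , gt′
  where
    pos′ : ∀ a b → 1 ≤ b → b ≤ a → a ≤ n → 1 ≤ shiftAlong c X a b
    pos′ a b 1≤b b≤a a≤n with <-≤-connex b c
    ... | inj₁ b<c = subst (1 ≤_) (sym (shiftAlong-left X a (<⇒≤ b<c))) (pos a b 1≤b b≤a a≤n)
    ... | inj₂ c≤b with diagonal c≤b b≤a
    ...   | on-diagonal s p c≤s =
      subst (1 ≤_) (sym (shiftAlong-diagonal X s p)) (pos s c 1≤c c≤s (≤-trans (m≤m+n s p) a≤n))
    gt′ : ∀ a b → 1 ≤ b → b ≤ a → suc a ≤ n →
          shiftAlong c X (suc a) b ≤ shiftAlong c X a b × shiftAlong c X a b ≤ shiftAlong c X (suc a) (suc b)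
    gt′ a b 1≤b b≤a a<n with <-≤-connex b c
    ... | inj₁ b<c =
      subst₂ _≤_ (sym (shiftAlong-left X (suc a) (<⇒≤ b<c))) (sym (shiftAlong-left X a (<⇒≤ b<c)))
        (proj₁ (gt a b 1≤b b≤a a<n)) ,
      subst₂ _≤_ (sym (shiftAlong-left X a (<⇒≤ b<c))) (sym (shiftAlong-left X (suc a) b<c))
        (proj₂ (gt a b 1≤b b≤a a<n))
    ... | inj₂ c≤b with diagonal c≤b b≤a
    ...   | on-diagonal s p c≤s =
      subst₂ _≤_ (sym (shiftAlong-diagonal X (suc s) p)) (sym (shiftAlong-diagonal X s p))
        (proj₁ (gt s c 1≤c c≤s (≤-trans (s≤s (m≤m+n s p)) a<n))) ,
      ≤-reflexive (sym (shiftAlong-step X (s + p) c≤b))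

DiagonalRule : ℕ → ℕ → Array → Set
DiagonalRule n k X = ∀ {i j} → k ≤ j → j ≤ i → suc i ≤ n →
  (X i j ≡ X (suc i) j → X (suc i) (suc j) ≡ suc (X i j)) ×
  (X i j ≢ X (suc i) j → X (suc i) (suc j) ≡ X i j)

step-off : ∀ n i j Y a b → covered? n i j a b ≡ false → step n i j Y a b ≡ Y a b
step-off n i j Y a b off with Y i j ≟ Y (suc i) j
... | yes inversion rewrite dec-true (Y i j ≟ Y (suc i) j) inversion | off = refl
... | no no-inversion rewrite dec-false (Y i j ≟ Y (suc i) j) no-inversion = refl

step-lowers : ∀ n i j Y a b → covered? n i j a b ≡ true → Y i j ≡ Y (suc i) j → step n i j Y a b ≡ Y a b ∸ 1
step-lowers n i j Y a b on inversion rewrite dec-true (Y i j ≟ Y (suc i) j) inversion | on = refl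

step-keeps : ∀ n i j Y a b → Y i j ≢ Y (suc i) j → step n i j Y a b ≡ Y a b
step-keeps n i j Y a b no-inversion rewrite dec-false (Y i j ≟ Y (suc i) j) no-inversion = refl

witness : ∀ {P : Set} (d : Dec P) → does d ≡ true → P
witness (yes p) _ = p
witness (no _) ()

module Procedure (n k : ℕ) (X : Array) (rule : DiagonalRule n k X) where

  -- The array while diagonal j is processed and rows ≥ q are done: an entry
  -- right of column j shows its column-j value once the row of its diagonal
  -- origin is ≥ q, and its column-(j+1) value before.
  mid : ℕ → ℕ → Array
  mid j q a b = if does (q + (b ∸ j) ≤? a) then shiftAlong j X a b else shiftAlong (suc j) X a b

  mid-left : ∀ {j} q a {b} → b ≤ j → mid j q a b ≡ X a b
  mid-left {j} q a {b} b≤j with does (q + (b ∸ j) ≤? a)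
  ... | true  = shiftAlong-left X a b≤j
  ... | false = shiftAlong-left X a (m≤n⇒m≤1+n b≤j)

  -- Before row n-1 is processed nothing has moved yet; after row j the
  -- shift has reached column j.
  mid-start : ∀ j → Agree n (mid j n) (shiftAlong (suc j) X)
  mid-start j a b b≤a a≤n with b ≤? j
  ... | yes b≤j = trans (mid-left n a b≤j) (sym (shiftAlong-left X a (m≤n⇒m≤1+n b≤j)))
  ... | no  b≰j = if-cong (dec-false (n + (b ∸ j) ≤? a) beyond)
    where
      beyond : ¬ (n + (b ∸ j) ≤ a)
      beyond le = n≮n n (≤-trans (m<m+n n (m<n⇒0<n∸m (≰⇒> b≰j))) (≤-trans le a≤n))

  mid-end : ∀ j → Agree n (mid j j) (shiftAlong j X)
  mid-end j a b b≤a a≤n with b ≤? j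
  ... | yes b≤j = trans (mid-left j a b≤j) (sym (shiftAlong-left X a b≤j))
  ... | no  b≰j = if-cong (dec-true (j + (b ∸ j) ≤? a) reached)
    where
      reached : j + (b ∸ j) ≤ a
      reached = subst (_≤ a) (sym (m+[n∸m]≡n (<⇒≤ (≰⇒> b≰j)))) b≤a

  covered-sound : ∀ i j a b → covered? n i j a b ≡ true → i < a × b ≡ j + (a ∸ i)
  covered-sound i j a b c =
    witness (i <? a) (∧-conicalˡ (does (i <? a)) _ c) ,
    witness (b ≟ j + (a ∸ i)) (∧-conicalʳ (does (a ≤? n)) _ (∧-conicalʳ (does (i <? a)) _ c))

  covered-complete : ∀ i j a b → i < a → a ≤ n → b ≡ j + (a ∸ i) → covered? n i j a b ≡ true
  covered-complete i j a b i<a a≤n on =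
    cong₂ _∧_ (dec-true (i <? a) i<a) (cong₂ _∧_ (dec-true (a ≤? n) a≤n) (dec-true (b ≟ j + (a ∸ i)) on))

  covered-position : ∀ i j a b → covered? n i j a b ≡ true → ∃ λ p → a ≡ i + suc p × b ≡ j + suc p
  covered-position i j a b c = p , a≡ , trans on (cong (j +_) (trans (cong (_∸ i) a≡) (m+n∸m≡n i (suc p))))
    where
      on : b ≡ j + (a ∸ i)
      on = proj₂ (covered-sound i j a b c)
      p : ℕ
      p = a ∸ suc i
      a≡ : a ≡ i + suc p
      a≡ = sym (trans (+-suc i p) (m+[n∸m]≡n (proj₁ (covered-sound i j a b c))))

  mid-covered-before : ∀ i j p → mid j (suc i) (i + suc p) (j + suc p) ≡ X (suc i) (suc j)
  mid-covered-before i j p =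
    trans (if-cong (dec-false (suc i + (j + suc p ∸ j) ≤? i + suc p) not-reached))
          (trans (cong₂ (shiftAlong (suc j) X) (+-suc i p) (+-suc j p)) (shiftAlong-diagonal X (suc i) p))
    where
      not-reached : ¬ (suc i + (j + suc p ∸ j) ≤ i + suc p)
      not-reached le =
        n≮n i (+-cancelʳ-≤ (suc p) (suc i) i (subst (λ d → suc i + d ≤ i + suc p) (m+n∸m≡n j (suc p)) le))

  mid-covered-after : ∀ i j p → mid j i (i + suc p) (j + suc p) ≡ X i j
  mid-covered-after i j p =
    trans (if-cong (dec-true (i + (j + suc p ∸ j) ≤? i + suc p) reached)) (shiftAlong-diagonal X i (suc p))
    where
      reached : i + (j + suc p ∸ j) ≤ i + suc p
      reached = ≤-reflexive (cong (i +_) (m+n∸m≡n j (suc p)))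

  uncovered-agree : ∀ i j a b → covered? n i j a b ≡ false → b ≤ a → a ≤ n → mid j (suc i) a b ≡ mid j i a b
  uncovered-agree i j a b unc b≤a a≤n with b ≤? j
  ... | yes b≤j = trans (mid-left (suc i) a b≤j) (sym (mid-left i a b≤j))
  ... | no  b≰j with i + (b ∸ j) ≟ a
  ...   | yes on = contradiction (trans (sym unc) (covered-complete i j a b i<a a≤n b-on)) λ ()
    where
      i<a : i < a
      i<a = subst (i <_) on (m<m+n i (m<n⇒0<n∸m (≰⇒> b≰j)))
      b-on : b ≡ j + (a ∸ i)
      b-on = trans (sym (m+[n∸m]≡n (<⇒≤ (≰⇒> b≰j))))
                   (cong (j +_) (sym (trans (cong (_∸ i) (sym on)) (m+n∸m≡n i (b ∸ j)))))
  ...   | no off = if-cong (does-⇔ (mk⇔ (≤-trans (n≤1+n (i + (b ∸ j)))) (λ le → ≤∧≢⇒< le off))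
                                   (suc i + (b ∸ j) ≤? a) (i + (b ∸ j) ≤? a))

  column-read : ∀ {i j} Y → j ≤ i → suc i ≤ n → Agree n Y (mid j (suc i)) →
                Y i j ≡ X i j × Y (suc i) j ≡ X (suc i) j
  column-read {i} {j} Y j≤i i<n Y≈mid =
    trans (Y≈mid i j j≤i (<⇒≤ i<n)) (mid-left (suc i) i ≤-refl) ,
    trans (Y≈mid (suc i) j (m≤n⇒m≤1+n j≤i) i<n) (mid-left (suc i) (suc i) ≤-refl)

  -- One step of the procedure: covered entries move from their column-(j+1)
  -- value to their column-j value, by the diagonal rule.
  step-agrees : ∀ {i j} Y → k ≤ j → j ≤ i → suc i ≤ n → Agree n Y (mid j (suc i)) → Agree n (step n i j Y) (mid j i)
  step-agrees {i} {j} Y k≤j j≤i i<n Y≈mid a b b≤a a≤n with covered? n i j a b in cov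
  ... | false = trans (step-off n i j Y a b cov) (trans (Y≈mid a b b≤a a≤n) (uncovered-agree i j a b cov b≤a a≤n))
  ... | true with covered-position i j a b cov
  ...   | p , refl , refl with Y i j ≟ Y (suc i) j
  ...     | yes inversion = begin
              step n i j Y a b       ≡⟨ step-lowers n i j Y a b cov inversion ⟩
              Y a b ∸ 1              ≡⟨ cong (_∸ 1) (trans (Y≈mid a b b≤a a≤n) (mid-covered-before i j p)) ⟩
              X (suc i) (suc j) ∸ 1  ≡⟨ cong (_∸ 1) (proj₁ (rule k≤j j≤i i<n) X-inversion) ⟩
              X i j                  ≡⟨ sym (mid-covered-after i j p) ⟩
              mid j i a b            ∎
    where
      reads : Y i j ≡ X i j × Y (suc i) j ≡ X (suc i) j
      reads = column-read Y j≤i i<n Y≈mid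
      X-inversion : X i j ≡ X (suc i) j
      X-inversion = trans (sym (proj₁ reads)) (trans inversion (proj₂ reads))
  ...     | no no-inversion = begin
              step n i j Y a b       ≡⟨ step-keeps n i j Y a b no-inversion ⟩
              Y a b                  ≡⟨ trans (Y≈mid a b b≤a a≤n) (mid-covered-before i j p) ⟩
              X (suc i) (suc j)      ≡⟨ proj₂ (rule k≤j j≤i i<n) X-no-inversion ⟩
              X i j                  ≡⟨ sym (mid-covered-after i j p) ⟩
              mid j i a b            ∎
    where
      reads : Y i j ≡ X i j × Y (suc i) j ≡ X (suc i) j
      reads = column-read Y j≤i i<n Y≈mid
      X-no-inversion : X i j ≢ X (suc i) j
      X-no-inversion e = no-inversion (trans (proj₁ reads) (trans e (sym (proj₂ reads))))

  rows-agree : ∀ j t Y → k ≤ j → j + t ≤ n → Agree n Y (mid j (j + t)) → Agree n (rowsLoop n j t Y) (mid j j)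
  rows-agree j zero    Y k≤j _     Y≈mid = subst (λ q → Agree n Y (mid j q)) (+-identityʳ j) Y≈mid
  rows-agree j (suc t) Y k≤j j+t≤n Y≈mid =
    rows-agree j t (step n (j + t) j Y) k≤j (<⇒≤ i<n)
      (step-agrees Y k≤j (m≤m+n j t) i<n (subst (λ q → Agree n Y (mid j q)) (+-suc j t) Y≈mid))
    where
      i<n : suc (j + t) ≤ n
      i<n = subst (_≤ n) (+-suc j t) j+t≤n

  diagonal-agrees : ∀ j Y → k ≤ j → j ≤ n → Agree n Y (shiftAlong (suc j) X) →
                    Agree n (processDiagonal n j Y) (shiftAlong j X)
  diagonal-agrees j Y k≤j j≤n Y≈shift =
    Agree-trans (rows-agree j (n ∸ j) Y k≤j (≤-reflexive rows) start) (mid-end j)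
    where
      rows : j + (n ∸ j) ≡ n
      rows = m+[n∸m]≡n j≤n
      start : Agree n Y (mid j (j + (n ∸ j)))
      start = subst (λ q → Agree n Y (mid j q)) (sym rows) (Agree-trans Y≈shift (Agree-sym (mid-start j)))

  diagonals-agree : ∀ t Y → k + t ≤ suc n → Agree n Y (shiftAlong (k + t) X) →
                    Agree n (diagLoop n k t Y) (shiftAlong k X)
  diagonals-agree zero    Y _       Y≈shift = subst (λ c → Agree n Y (shiftAlong c X)) (+-identityʳ k) Y≈shift
  diagonals-agree (suc t) Y k+t≤n+1 Y≈shift =
    diagonals-agree t (processDiagonal n (k + t) Y) (<⇒≤ j<n+1)
      (diagonal-agrees (k + t) Y (m≤m+n k t) (≤-pred j<n+1)
        (subst (λ c → Agree n Y (shiftAlong c X)) (+-suc k t) Y≈shift))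
    where
      j<n+1 : suc (k + t) ≤ suc n
      j<n+1 = subst (_≤ suc n) (+-suc k t) k+t≤n+1

  -- The whole procedure: X is shiftAlong (n+1) X to begin with.
  procedure-shifts : k ≤ n → Agree n (standardProcedure n k X) (shiftAlong k X)
  procedure-shifts k≤n = diagonals-agree (suc (n ∸ k)) X (≤-reflexive all-diagonals) unshifted
    where
      all-diagonals : k + suc (n ∸ k) ≡ suc n
      all-diagonals = trans (+-suc k (n ∸ k)) (cong suc (m+[n∸m]≡n k≤n))
      unshifted : Agree n X (shiftAlong (k + suc (n ∸ k)) X)
      unshifted a b b≤a a≤n =
        sym (shiftAlong-left X a (subst (b ≤_) (sym all-diagonals) (≤-trans b≤a (m≤n⇒m≤1+n a≤n))))

update : Array → ℕ → ℕ → ℕ → Array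
update X p q v a b = if does ((a ≟ p) ×-dec (b ≟ q)) then v else X a b

update-here : ∀ X p q v → update X p q v p q ≡ v
update-here X p q v rewrite dec-true ((p ≟ p) ×-dec (q ≟ q)) (refl , refl) = refl

update-elsewhere : ∀ X p q v a b → ¬ (a ≡ p × b ≡ q) → update X p q v a b ≡ X a b
update-elsewhere X p q v a b off rewrite dec-false ((a ≟ p) ×-dec (b ≟ q)) off = refl

update-≤ : ∀ X p q v → v ≤ X p q → ∀ a b → update X p q v a b ≤ X a b
update-≤ X p q v v≤ a b with (a ≟ p) ×-dec (b ≟ q)
... | yes (refl , refl) = subst (_≤ X a b) (sym (update-here X a b v)) v≤
... | no off            = ≤-reflexive (update-elsewhere X p q v a b off)

-- Lowering one entry keeps an inequality e + X s ≤ X t, provided it holds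
-- with v in place of X t when t is the lowered entry (e = 1 gives '<').
update-mono : ∀ X p q v → v ≤ X p q → ∀ e a b a′ b′ → e + X a b ≤ X a′ b′ →
              (a′ ≡ p → b′ ≡ q → e + X a b ≤ v) →
              e + update X p q v a b ≤ update X p q v a′ b′
update-mono X p q v v≤ e a b a′ b′ le target with (a′ ≟ p) ×-dec (b′ ≟ q)
... | yes (refl , refl) =
  subst (e + update X a′ b′ v a b ≤_) (sym (update-here X a′ b′ v))
        (≤-trans (+-monoʳ-≤ e (update-≤ X a′ b′ v v≤ a b)) (target refl refl))
... | no off =
  subst (e + update X p q v a b ≤_) (sym (update-elsewhere X p q v a′ b′ off))
        (≤-trans (+-monoʳ-≤ e (update-≤ X p q v v≤ a b)) le)

lower-Gog : ∀ {n X i j v} → IsGog n X → 1 ≤ j → j ≤ i → suc (suc i) ≤ n →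
            X i j ≤ v → X (suc i) j < v → X (suc (suc i)) (suc j) ≤ v → v ≤ X (suc i) (suc j) →
            IsGog n (update X (suc i) (suc j) v)
lower-Gog {n} {X} {i} {j} {v} ((pos , gt) , strict , bottom) 1≤j j≤i i+1<n above≤v left<v below≤v v≤old =
  (pos′ , gt′) , strict′ , bottom′
  where
    Z : Array
    Z = update X (suc i) (suc j) v
    mono : ∀ e a b a′ b′ → e + X a b ≤ X a′ b′ → (a′ ≡ suc i → b′ ≡ suc j → e + X a b ≤ v) → e + Z a b ≤ Z a′ b′
    mono = update-mono X (suc i) (suc j) v v≤old
    pos′ : ∀ a b → 1 ≤ b → b ≤ a → a ≤ n → 1 ≤ Z a b
    pos′ a b 1≤b b≤a a≤n with (a ≟ suc i) ×-dec (b ≟ suc j)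
    ... | yes (refl , refl) = subst (1 ≤_) (sym (update-here X a b v)) (≤-trans (s≤s z≤n) left<v)
    ... | no off = subst (1 ≤_) (sym (update-elsewhere X (suc i) (suc j) v a b off)) (pos a b 1≤b b≤a a≤n)
    gt′ : ∀ a b → 1 ≤ b → b ≤ a → suc a ≤ n → Z (suc a) b ≤ Z a b × Z a b ≤ Z (suc a) (suc b)
    gt′ a b 1≤b b≤a a<n =
      mono 0 (suc a) b a b (proj₁ (gt a b 1≤b b≤a a<n)) (λ { refl refl → below≤v }) ,
      mono 0 a b (suc a) (suc b) (proj₂ (gt a b 1≤b b≤a a<n)) (λ { refl refl → above≤v })
    strict′ : ∀ a b → 1 ≤ b → suc b ≤ a → a ≤ n → Z a b < Z a (suc b)
    strict′ a b 1≤b b<a a≤n = mono 1 a b a (suc b) (strict a b 1≤b b<a a≤n) (λ { refl refl → left<v })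
    bottom′ : ∀ b → 1 ≤ b → b ≤ n → Z n b ≡ b
    bottom′ b 1≤b b≤n =
      trans (update-elsewhere X (suc i) (suc j) v n b (λ (n≡ , _) → n≮n n (subst (_≤ n) (cong suc (sym n≡)) i+1<n)))
            (bottom b 1≤b b≤n)

module Completion (n k : ℕ) (1≤k : 1 ≤ k) (T X : Array) (canonical : IsCanonicalCompletion n k T X) where

  gog : IsGog n X
  gog = proj₁ canonical

  gt : ∀ a b → 1 ≤ b → b ≤ a → suc a ≤ n → X (suc a) b ≤ X a b × X a b ≤ X (suc a) (suc b)
  gt = proj₂ (proj₁ gog)

  strict : ∀ a b → 1 ≤ b → suc b ≤ a → a ≤ n → X a b < X a (suc b)
  strict = proj₁ (proj₂ gog)

  bottom : ∀ b → 1 ≤ b → b ≤ n → X n b ≡ b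
  bottom = proj₂ (proj₂ gog)

  -- Minimality: a free interior entry is no larger than its largest lower bound,
  -- since lowering it to that bound gives a smaller Gog completion of T.
  tight : ∀ {i j} → k ≤ j → j ≤ i → suc (suc i) ≤ n →
          X (suc i) (suc j) ≤ X i j ⊔ suc (X (suc i) j) ⊔ X (suc (suc i)) (suc j)
  tight {i} {j} k≤j j≤i i+1<n =
    subst (X (suc i) (suc j) ≤_) (update-here X (suc i) (suc j) v)
      (proj₂ (proj₂ canonical) Z Z-Gog Z-restricts (suc i) (suc j) (s≤s z≤n) (s≤s j≤i) i<n)
    where
      v : ℕ
      v = X i j ⊔ suc (X (suc i) j) ⊔ X (suc (suc i)) (suc j)
      Z : Array
      Z = update X (suc i) (suc j) v
      1≤j : 1 ≤ j
      1≤j = ≤-trans 1≤k k≤j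
      i<n : suc i ≤ n
      i<n = <⇒≤ i+1<n
      v≤old : v ≤ X (suc i) (suc j)
      v≤old = ⊔-lub (⊔-lub (proj₂ (gt i j 1≤j j≤i i<n)) (strict (suc i) j 1≤j (s≤s j≤i) i<n))
                    (proj₁ (gt (suc i) (suc j) (s≤s z≤n) (s≤s j≤i) i+1<n))
      Z-Gog : IsGog n Z
      Z-Gog = lower-Gog gog 1≤j j≤i i+1<n
                (≤-trans (m≤m⊔n _ _) (m≤m⊔n _ _)) (≤-trans (m≤n⊔m (X i j) _) (m≤m⊔n _ _)) (m≤n⊔m _ _) v≤old
      Z-restricts : Restricts n k Z T
      Z-restricts a b 1≤b b≤k b≤a a≤n =
        trans (update-elsewhere X (suc i) (suc j) v a b
                 (λ (_ , b≡) → n≮n k (≤-trans (s≤s k≤j) (subst (_≤ k) b≡ b≤k))))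
              (proj₁ (proj₂ canonical) a b 1≤b b≤k b≤a a≤n)

  -- Downward induction on the row (m = n - i - 1): the third lower bound in
  -- 'tight' is dominated by the second.
  growth : ∀ m {i j} → suc i + m ≡ n → k ≤ j → j ≤ i → X (suc i) (suc j) ≤ X i j ⊔ suc (X (suc i) j)
  growth zero {i} {j} last k≤j j≤i = ≤-trans (≤-reflexive bottom-step) (m≤n⊔m (X i j) _)
    where
      row : suc i ≡ n
      row = trans (sym (+-identityʳ (suc i))) last
      bottom-step : X (suc i) (suc j) ≡ suc (X (suc i) j)
      bottom-step = begin
        X (suc i) (suc j)  ≡⟨ cong (λ r → X r (suc j)) row ⟩
        X n (suc j)        ≡⟨ bottom (suc j) (s≤s z≤n) (subst (suc j ≤_) row (s≤s j≤i)) ⟩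
        suc j              ≡⟨ cong suc (sym (bottom j (≤-trans 1≤k k≤j) (subst (j ≤_) row (m≤n⇒m≤1+n j≤i)))) ⟩
        suc (X n j)        ≡⟨ cong (λ r → suc (X r j)) (sym row) ⟩
        suc (X (suc i) j)  ∎
  growth (suc m) {i} {j} rest k≤j j≤i =
    ≤-trans (tight k≤j j≤i i+1<n) (⊔-lub ≤-refl (≤-trans below (m≤n⊔m (X i j) _)))
    where
      rest′ : suc (suc i) + m ≡ n
      rest′ = trans (sym (+-suc (suc i) m)) rest
      i+1<n : suc (suc i) ≤ n
      i+1<n = subst (suc (suc i) ≤_) rest′ (m≤m+n (suc (suc i)) m)
      below : X (suc (suc i)) (suc j) ≤ suc (X (suc i) j)
      below = ≤-trans (growth m rest′ k≤j (m≤n⇒m≤1+n j≤i))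
                (⊔-lub (n≤1+n _) (s≤s (proj₁ (gt (suc i) j (≤-trans 1≤k k≤j) (m≤n⇒m≤1+n j≤i) i+1<n))))

  diagonal-rule : DiagonalRule n k X
  diagonal-rule {i} {j} k≤j j≤i i<n = inversion , no-inversion
    where
      1≤j : 1 ≤ j
      1≤j = ≤-trans 1≤k k≤j
      bound : X (suc i) (suc j) ≤ X i j ⊔ suc (X (suc i) j)
      bound = growth (n ∸ suc i) (m+[n∸m]≡n i<n) k≤j j≤i
      inversion : X i j ≡ X (suc i) j → X (suc i) (suc j) ≡ suc (X i j)
      inversion eq = ≤-antisym
        (subst (X (suc i) (suc j) ≤_) (trans (cong (λ x → X i j ⊔ suc x) (sym eq)) (m≤n⇒m⊔n≡n (n≤1+n (X i j)))) bound)
        (subst (λ x → suc x ≤ X (suc i) (suc j)) (sym eq) (strict (suc i) j 1≤j (s≤s j≤i) i<n))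
      no-inversion : X i j ≢ X (suc i) j → X (suc i) (suc j) ≡ X i j
      no-inversion ne = ≤-antisym
        (subst (X (suc i) (suc j) ≤_) (m≥n⇒m⊔n≡m (≤∧≢⇒< (proj₁ (gt i j 1≤j j≤i i<n)) (λ e → ne (sym e)))) bound)
        (proj₂ (gt i j 1≤j j≤i i<n))

-- The procedure turns X into shiftAlong k X, which is Gelfand-Tsetlin and
-- carries X i k along the diagonal through (i, k).
mainTheorem4 : (n k : ℕ) → 1 ≤ k → k ≤ n → (T X : Array) →
    IsLeftGogTrapezoid n k T → IsCanonicalCompletion n k T X →
    IsGT n (standardProcedure n k X) ×
    (∀ i l → k ≤ i → i ≤ n → 1 ≤ l → l ≤ n ∸ i →
       standardProcedure n k X (i + l) (k + l) ≡ X i k)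
mainTheorem4 n k 1≤k k≤n T X _ canonical = result-GT , result-diagonals
  where
    open Completion n k 1≤k T X canonical using (gog; diagonal-rule)
    open Procedure n k X diagonal-rule using (procedure-shifts)

    result≈shift : Agree n (standardProcedure n k X) (shiftAlong k X)
    result≈shift = procedure-shifts k≤n

    result-GT : IsGT n (standardProcedure n k X)
    result-GT = IsGT-resp (Agree-sym result≈shift) (shiftAlong-GT 1≤k (proj₁ gog))

    result-diagonals : ∀ i l → k ≤ i → i ≤ n → 1 ≤ l → l ≤ n ∸ i →
                       standardProcedure n k X (i + l) (k + l) ≡ X i k
    result-diagonals i l k≤i i≤n _ l≤n∸i =
      trans (result≈shift (i + l) (k + l) (+-monoˡ-≤ l k≤i) i+l≤n) (shiftAlong-diagonal X i l)
      where
        i+l≤n : i + l ≤ n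
        i+l≤n = ≤-trans (+-monoʳ-≤ i l≤n∸i) (≤-reflexive (m+[n∸m]≡n i≤n))
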